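{- Let $F(t)=t^2-t+1$ and $G(t)=F(-t)=t^2+t+1$. Let $f,g\in\mathbb{Q}[t]$ with $\deg f=\deg g=2$ such that $fg$ divides $f^3+g^3+8$ in $\mathbb{Q}[t]$, and suppose there do not exist $f_1,g_1,h\in\mathbb{Q}[t]$ with $\deg h\ge 2$, $f=f_1\circ h$, $g=g_1\circ h$. Then there exist $\alpha\in\mathbb{Q}\setminus\{0\}$ and $\beta\in\mathbb{Q}$ with $f(t)=F(\alpha t+\beta)$ and $g(t)=G(\alpha t+\beta)$; conversely every such pair has these properties.
   Context: Solutions are considered up to affine reparametrization $t\mapsto\alpha t+\beta$ ($\alpha\in\mathbb{Q}\setminus\{0\}$, $\beta\in\mathbb{Q}$); a solution that is a composition with a polynomial $h$ of degree at least $2$ is called trivial. -}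

module Defs where

open import Data.Nat using (ℕ; zero; suc; _≤_; _<_)
open import Data.List using (List; []; _∷_)
open import Data.Product using (Σ; _×_; ∃; ∃-syntax)
open import Relation.Binary.PropositionalEquality using (_≡_; _≢_)
import Data.Rational as Q
open Q using (ℚ; 0ℚ; 1ℚ)
import Data.Integer as Z

-- Polynomials in ℚ[t] as coefficient lists, lowest degree first.
-- Two lists represent the same polynomial iff all coefficients agree
-- (so trailing zeros are irrelevant).
Poly : Set
Poly = List ℚ

coeff : Poly → ℕ → ℚ
coeff []       _       = 0ℚ
coeff (a ∷ p)  zero    = a
coeff (a ∷ p)  (suc i) = coeff p i

infix 4 _≈ₚ_
_≈ₚ_ : Poly → Poly → Set
p ≈ₚ q = ∀ i → coeff p i ≡ coeff q i

HasDegree : Poly → ℕ → Set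
HasDegree p n = (coeff p n ≢ 0ℚ) × (∀ i → n < i → coeff p i ≡ 0ℚ)

const : ℚ → Poly
const a = a ∷ []

X : Poly
X = 0ℚ ∷ 1ℚ ∷ []

infixl 6 _+ₚ_
_+ₚ_ : Poly → Poly → Poly
[]      +ₚ q       = q
(a ∷ p) +ₚ []      = a ∷ p
(a ∷ p) +ₚ (b ∷ q) = (a Q.+ b) ∷ (p +ₚ q)

scale : ℚ → Poly → Poly
scale c []      = []
scale c (a ∷ p) = (c Q.* a) ∷ scale c p

infixl 7 _*ₚ_
_*ₚ_ : Poly → Poly → Poly
[]      *ₚ q = []
(a ∷ p) *ₚ q = scale a q +ₚ (0ℚ ∷ (p *ₚ q))

infix 4 _∣ₚ_
_∣ₚ_ : Poly → Poly → Set
p ∣ₚ q = ∃[ r ] (p *ₚ r ≈ₚ q)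

infixr 9 _∘ₚ_
_∘ₚ_ : Poly → Poly → Poly
[]      ∘ₚ h = []
(a ∷ p) ∘ₚ h = const a +ₚ (h *ₚ (p ∘ₚ h))

cube : Poly → Poly
cube p = p *ₚ p *ₚ p

F : Poly
F = 1ℚ ∷ Q.- 1ℚ ∷ 1ℚ ∷ []

G : Poly
G = 1ℚ ∷ 1ℚ ∷ 1ℚ ∷ []

eight : ℚ
eight = Z.+ 8 Q./ 1

affine : ℚ → ℚ → Poly
affine α β = β ∷ α ∷ []

IsSolution : Poly → Poly → Set
IsSolution f g = HasDegree f 2 × HasDegree g 2
               × (f *ₚ g ∣ₚ cube f +ₚ cube g +ₚ const eight)

IsTrivial : Poly → Poly → Set
IsTrivial f g = ∃[ f₁ ] ∃[ g₁ ] ∃[ h ]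
  ((∃[ n ] (2 ≤ n × HasDegree h n)) × (f ≈ₚ f₁ ∘ₚ h) × (g ≈ₚ g₁ ∘ₚ h))

-- A polynomial over ℚ is determined by its values, so identities between polynomials reduce to
-- identities in ℚ, which the ring solver proves.
--
-- If (f, g) is a nontrivial solution and L is the ratio of leading coefficients, then g - Lf
-- is linear and nonconstant; after an affine change of variable s, the pair becomes (q, Lq + s).
-- Modulo q we have Lq + s ≡ s, so q ∣ s³ + 8; modulo Lq + s we have q ≡ -s/L, so after
-- s ↦ -Ls the second polynomial also divides s³ + 8. A rational quadratic dividing s³ - w³ is
-- a multiple of s² + ws + w², because cubing is injective on ℚ. Comparing the two
-- factorisations forces L = 1 and q(s) = (s² - 2s + 4)/4 = F(s/2), so g(s) = G(s/2).
-- Conversely F G (2t² + 10) = F³ + G³ + 8, and G - F = 2t is linear, whereas a composite with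
-- an inner polynomial of degree ≥ 2 never is.
module Submission where

open import Defs

open import Agda.Builtin.FromNat using (Number; fromNat)
open import Data.Empty using (⊥-elim)
import Data.Integer as ℤ
import Data.Integer.Properties as ℤP
open import Data.List using ([]; _∷_; length)
open import Data.Nat as ℕ using (ℕ; zero; suc; z≤n; s≤s)
import Data.Nat.Literals as ℕ-Literals
import Data.Nat.Properties as ℕP
open import Data.Product using (_×_; _,_; proj₁; proj₂; ∃-syntax)
open import Data.Rational
  using (ℚ; 0ℚ; 1ℚ; _+_; _*_; -_; _-_; 1/_; _≤_; ½; ↥_; NonZero; ≢-nonZero; nonNegative; nonPositive)
open import Data.Rational.Literals using (fromℤ; number)
import Data.Rational.Properties as ℚP
open import Algebra.Properties.Group ℚP.+-0-group
  using (x∙y⁻¹≈ε⇒x≈y; x≈y⇒x∙y⁻¹≈ε; inverseˡ-unique; inverseʳ-unique)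
open import Data.Sum using (_⊎_; inj₁; inj₂)
open import Data.Unit using (tt)
open import Function using (case_of_)
open import Level using (0ℓ)
open import Relation.Binary.Definitions using (tri<; tri≈; tri>)
open import Relation.Binary.PropositionalEquality
open import Relation.Nullary using (¬_; yes; no; contradiction)
open import Relation.Nullary.Decidable using (dec⇒maybe)
open import Tactic.RingSolver using (solve-∀; solve)
open import Tactic.RingSolver.Core.AlmostCommutativeRing
  using (AlmostCommutativeRing; fromCommutativeRing)

instance
  ℕ-number : Number ℕ
  ℕ-number = ℕ-Literals.number

  ℚ-number : Number ℚ
  ℚ-number = number

ℚ-ring : AlmostCommutativeRing 0ℓ 0ℓ
ℚ-ring = fromCommutativeRing ℚP.+-*-commutativeRing (λ x → dec⇒maybe (0ℚ ℚP.≟ x))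

open ≡-Reasoning

p-q≡0⇒p≡q : ∀ {p q} → p - q ≡ 0ℚ → p ≡ q
p-q≡0⇒p≡q = x∙y⁻¹≈ε⇒x≈y _ _

p≡q⇒p-q≡0 : ∀ {p q} → p ≡ q → p - q ≡ 0ℚ
p≡q⇒p-q≡0 = x≈y⇒x∙y⁻¹≈ε

*-cancelˡ-≡0 : ∀ {p q} → p ≢ 0ℚ → p * q ≡ 0ℚ → q ≡ 0ℚ
*-cancelˡ-≡0 {p} {q} p≢0 pq≡0 = begin
  q              ≡⟨ solve (q ∷ []) ℚ-ring ⟩
  1ℚ * q         ≡⟨ cong (_* q) (sym (ℚP.*-inverseˡ p)) ⟩
  1/ p * p * q   ≡⟨ ℚP.*-assoc (1/ p) p q ⟩
  1/ p * (p * q) ≡⟨ cong (1/ p *_) pq≡0 ⟩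
  1/ p * 0ℚ      ≡⟨ ℚP.*-zeroʳ (1/ p) ⟩
  0ℚ             ∎
  where instance _ = ≢-nonZero p≢0

*-≢0 : ∀ {p q} → p ≢ 0ℚ → q ≢ 0ℚ → p * q ≢ 0ℚ
*-≢0 p≢0 q≢0 pq≡0 = q≢0 (*-cancelˡ-≡0 p≢0 pq≡0)

p*p≡0⇒p≡0 : ∀ {p} → p * p ≡ 0ℚ → p ≡ 0ℚ
p*p≡0⇒p≡0 {p} pp≡0 with p ℚP.≟ 0ℚ
... | yes p≡0 = p≡0
... | no  p≢0 = *-cancelˡ-≡0 p≢0 pp≡0

p*p≥0 : ∀ p → 0ℚ ≤ p * p
p*p≥0 p with ℚP.≤-total 0ℚ p
... | inj₁ 0≤p = ℚP.nonNegative⁻¹ (p * p)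
  {{ℚP.nonNeg*nonNeg⇒nonNeg p {{nonNegative 0≤p}} p {{nonNegative 0≤p}}}}
... | inj₂ p≤0 = ℚP.nonNegative⁻¹ (p * p)
  {{ℚP.nonPos*nonPos⇒nonPos p {{nonPositive p≤0}} p {{nonPositive p≤0}}}}

p+q≡0⇒p≡0 : ∀ {p q} → 0ℚ ≤ p → 0ℚ ≤ q → p + q ≡ 0ℚ → p ≡ 0ℚ
p+q≡0⇒p≡0 {p} {q} 0≤p 0≤q p+q≡0 = ℚP.≤-antisym p≤0 0≤p
  where
  p≤0 : p ≤ 0ℚ
  p≤0 = subst₂ _≤_ (ℚP.+-identityʳ p) p+q≡0 (ℚP.+-monoʳ-≤ p 0≤q)

-- x³ - y³ = (x - y)((2x + y)² + 3y²) / 4, and the second factor vanishes only at x = y = 0.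
cube-injective : ∀ {x y} → x * x * x ≡ y * y * y → x ≡ y
cube-injective {x} {y} x³≡y³ with x ℚP.≟ y
... | yes x≡y = x≡y
... | no  x≢y = contradiction (trans x≡0 (sym y≡0)) x≢y
  where
  s = (2 * x + y) * (2 * x + y)
  t = 3 * (y * y)
  s+t≡0 : s + t ≡ 0ℚ
  s+t≡0 = *-cancelˡ-≡0 (λ x-y≡0 → x≢y (p-q≡0⇒p≡q x-y≡0)) (begin
    (x - y) * ((2 * x + y) * (2 * x + y) + 3 * (y * y)) ≡⟨ solve (x ∷ y ∷ []) ℚ-ring ⟩
    4 * (x * x * x - y * y * y)     ≡⟨ cong (4 *_) (p≡q⇒p-q≡0 x³≡y³) ⟩
    4 * 0ℚ                          ≡⟨ ℚP.*-zeroʳ 4 ⟩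
    0ℚ                              ∎)
  0≤t : 0ℚ ≤ t
  0≤t = ℚP.nonNegative⁻¹ t {{ℚP.nonNeg*nonNeg⇒nonNeg 3 (y * y) {{nonNegative (p*p≥0 y)}}}}
  y≡0 : y ≡ 0ℚ
  y≡0 = p*p≡0⇒p≡0 (*-cancelˡ-≡0 {p = 3} (λ ())
          (p+q≡0⇒p≡0 0≤t (p*p≥0 (2 * x + y)) (trans (ℚP.+-comm t s) s+t≡0)))
  x≡0 : x ≡ 0ℚ
  x≡0 = *-cancelˡ-≡0 {p = 2} (λ ()) (begin
    2 * x                ≡⟨ solve (x ∷ y ∷ []) ℚ-ring ⟩
    (2 * x + y) - y      ≡⟨ cong₂ _-_ (p*p≡0⇒p≡0 {2 * x + y} (p+q≡0⇒p≡0 (p*p≥0 (2 * x + y)) 0≤t s+t≡0)) y≡0 ⟩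
    0ℚ - 0ℚ              ≡⟨⟩
    0ℚ                   ∎)

eval : Poly → ℚ → ℚ
eval []      x = 0ℚ
eval (a ∷ p) x = a + x * eval p x

DegreeBelow : Poly → ℕ → Set
DegreeBelow p k = ∀ i → k ℕ.≤ i → coeff p i ≡ 0ℚ

infixl 6 _-ₚ_
_-ₚ_ : Poly → Poly → Poly
p -ₚ q = p +ₚ scale (- 1ℚ) q

+-neg-one : ∀ p q → p + - 1ℚ * q ≡ p - q
+-neg-one = solve-∀ ℚ-ring

coeff-+ₚ : ∀ p q i → coeff (p +ₚ q) i ≡ coeff p i + coeff q i
coeff-+ₚ []      q       i       = sym (ℚP.+-identityˡ (coeff q i))
coeff-+ₚ (a ∷ p) []      i       = sym (ℚP.+-identityʳ (coeff (a ∷ p) i))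
coeff-+ₚ (a ∷ p) (b ∷ q) zero    = refl
coeff-+ₚ (a ∷ p) (b ∷ q) (suc i) = coeff-+ₚ p q i

coeff-scale : ∀ c p i → coeff (scale c p) i ≡ c * coeff p i
coeff-scale c []      i       = sym (ℚP.*-zeroʳ c)
coeff-scale c (a ∷ p) zero    = refl
coeff-scale c (a ∷ p) (suc i) = coeff-scale c p i

coeff-diff : ∀ p q i → coeff (p -ₚ q) i ≡ coeff p i - coeff q i
coeff-diff p q i = begin
  coeff (p -ₚ q) i                       ≡⟨ coeff-+ₚ p (scale (- 1ℚ) q) i ⟩
  coeff p i + coeff (scale (- 1ℚ) q) i   ≡⟨ cong (coeff p i +_) (coeff-scale (- 1ℚ) q i) ⟩
  coeff p i + - 1ℚ * coeff q i           ≡⟨ +-neg-one (coeff p i) (coeff q i) ⟩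
  coeff p i - coeff q i                  ∎

coeff-beyond-length : ∀ p → DegreeBelow p (length p)
coeff-beyond-length []      i       _         = refl
coeff-beyond-length (a ∷ p) (suc i) (s≤s len≤i) = coeff-beyond-length p i len≤i

eval-≈[] : ∀ p → p ≈ₚ [] → ∀ x → eval p x ≡ 0ℚ
eval-≈[] []      p≈0 x = refl
eval-≈[] (a ∷ p) p≈0 x = begin
  a + x * eval p x   ≡⟨ cong₂ (λ b y → b + x * y) (p≈0 0) (eval-≈[] p (λ i → p≈0 (suc i)) x) ⟩
  0ℚ + x * 0ℚ        ≡⟨ solve (x ∷ []) ℚ-ring ⟩
  0ℚ                 ∎

eval-cong : ∀ p q → p ≈ₚ q → ∀ x → eval p x ≡ eval q x
eval-cong []      q       p≈q x = sym (eval-≈[] q (λ i → sym (p≈q i)) x)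
eval-cong (a ∷ p) []      p≈q x = eval-≈[] (a ∷ p) p≈q x
eval-cong (a ∷ p) (b ∷ q) p≈q x =
  cong₂ (λ c y → c + x * y) (p≈q 0) (eval-cong p q (λ i → p≈q (suc i)) x)

eval-+ₚ : ∀ p q x → eval (p +ₚ q) x ≡ eval p x + eval q x
eval-+ₚ []      q       x = sym (ℚP.+-identityˡ (eval q x))
eval-+ₚ (a ∷ p) []      x = sym (ℚP.+-identityʳ (eval (a ∷ p) x))
eval-+ₚ (a ∷ p) (b ∷ q) x = begin
  a + b + x * eval (p +ₚ q) x          ≡⟨ cong (λ y → a + b + x * y) (eval-+ₚ p q x) ⟩
  a + b + x * (eval p x + eval q x)    ≡⟨ regroup a b x (eval p x) (eval q x) ⟩
  a + x * eval p x + (b + x * eval q x) ∎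
  where
  regroup : ∀ a b x u v → a + b + x * (u + v) ≡ a + x * u + (b + x * v)
  regroup = solve-∀ ℚ-ring

eval-scale : ∀ c p x → eval (scale c p) x ≡ c * eval p x
eval-scale c []      x = sym (ℚP.*-zeroʳ c)
eval-scale c (a ∷ p) x = begin
  c * a + x * eval (scale c p) x   ≡⟨ cong (λ y → c * a + x * y) (eval-scale c p x) ⟩
  c * a + x * (c * eval p x)       ≡⟨ regroup c a x (eval p x) ⟩
  c * (a + x * eval p x)           ∎
  where
  regroup : ∀ c a x u → c * a + x * (c * u) ≡ c * (a + x * u)
  regroup = solve-∀ ℚ-ring

eval-diff : ∀ p q x → eval (p -ₚ q) x ≡ eval p x - eval q x
eval-diff p q x = begin
  eval (p -ₚ q) x                        ≡⟨ eval-+ₚ p (scale (- 1ℚ) q) x ⟩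
  eval p x + eval (scale (- 1ℚ) q) x     ≡⟨ cong (eval p x +_) (eval-scale (- 1ℚ) q x) ⟩
  eval p x + - 1ℚ * eval q x             ≡⟨ +-neg-one (eval p x) (eval q x) ⟩
  eval p x - eval q x                    ∎

eval-*ₚ : ∀ p q x → eval (p *ₚ q) x ≡ eval p x * eval q x
eval-*ₚ []      q x = sym (ℚP.*-zeroˡ (eval q x))
eval-*ₚ (a ∷ p) q x = begin
  eval (scale a q +ₚ (0ℚ ∷ p *ₚ q)) x            ≡⟨ eval-+ₚ (scale a q) (0ℚ ∷ p *ₚ q) x ⟩
  eval (scale a q) x + (0ℚ + x * eval (p *ₚ q) x) ≡⟨ cong₂ (λ y z → y + (0ℚ + x * z)) (eval-scale a q x) (eval-*ₚ p q x) ⟩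
  a * eval q x + (0ℚ + x * (eval p x * eval q x)) ≡⟨ regroup a x (eval p x) (eval q x) ⟩
  (a + x * eval p x) * eval q x                   ∎
  where
  regroup : ∀ a x u v → a * v + (0ℚ + x * (u * v)) ≡ (a + x * u) * v
  regroup = solve-∀ ℚ-ring

eval-∘ₚ : ∀ p h x → eval (p ∘ₚ h) x ≡ eval p (eval h x)
eval-∘ₚ []      h x = refl
eval-∘ₚ (a ∷ p) h x = begin
  eval (const a +ₚ h *ₚ (p ∘ₚ h)) x        ≡⟨ eval-+ₚ (const a) (h *ₚ (p ∘ₚ h)) x ⟩
  a + x * 0ℚ + eval (h *ₚ (p ∘ₚ h)) x      ≡⟨ cong (a + x * 0ℚ +_) (eval-*ₚ h (p ∘ₚ h) x) ⟩
  a + x * 0ℚ + eval h x * eval (p ∘ₚ h) x  ≡⟨ cong (λ y → a + x * 0ℚ + eval h x * y) (eval-∘ₚ p h x) ⟩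
  a + x * 0ℚ + eval h x * eval p (eval h x) ≡⟨ regroup a x (eval h x) (eval p (eval h x)) ⟩
  a + eval h x * eval p (eval h x)         ∎
  where
  regroup : ∀ a x y u → a + x * 0ℚ + y * u ≡ a + y * u
  regroup = solve-∀ ℚ-ring

eval-X : ∀ x → eval X x ≡ x
eval-X = identity
  where
  identity : ∀ x → 0ℚ + x * (1ℚ + x * 0ℚ) ≡ x
  identity = solve-∀ ℚ-ring

eval-cube : ∀ p x → eval (cube p) x ≡ eval p x * eval p x * eval p x
eval-cube p x = begin
  eval (p *ₚ p *ₚ p) x              ≡⟨ eval-*ₚ (p *ₚ p) p x ⟩
  eval (p *ₚ p) x * eval p x        ≡⟨ cong (_* eval p x) (eval-*ₚ p p x) ⟩
  eval p x * eval p x * eval p x    ∎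

-- A polynomial is determined by its values

infixl 7 _÷[t-_]
_÷[t-_] : Poly → ℚ → Poly
[]      ÷[t- a ] = []
(c ∷ p) ÷[t- a ] = eval p a ∷ (p ÷[t- a ])

eval-÷[t-] : ∀ p a x → eval p x ≡ eval p a + (x - a) * eval (p ÷[t- a ]) x
eval-÷[t-] []      a x = solve (x ∷ a ∷ []) ℚ-ring
eval-÷[t-] (c ∷ p) a x = begin
  c + x * eval p x                                  ≡⟨ cong (λ y → c + x * y) (eval-÷[t-] p a x) ⟩
  c + x * (eval p a + (x - a) * eval q x)           ≡⟨ regroup c x a (eval p a) (eval q x) ⟩
  c + a * eval p a + (x - a) * (eval p a + x * eval q x) ∎
  where
  q = p ÷[t- a ]
  regroup : ∀ c x a u v → c + x * (u + (x - a) * v) ≡ c + a * u + (x - a) * (u + x * v)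
  regroup = solve-∀ ℚ-ring

÷[t-]-degree : ∀ p {k} a → DegreeBelow p (suc k) → DegreeBelow (p ÷[t- a ]) k
÷[t-]-degree []      a deg i k≤i = refl
÷[t-]-degree (c ∷ p) {zero}  a deg zero    _ =
  eval-≈[] p (λ i → deg (suc i) (s≤s z≤n)) a
÷[t-]-degree (c ∷ p) {zero}  a deg (suc i) _ =
  ÷[t-]-degree p {zero} a (λ j 1≤j → deg (suc j) (s≤s z≤n)) i z≤n
÷[t-]-degree (c ∷ p) {suc k} a deg (suc i) (s≤s k≤i) =
  ÷[t-]-degree p {k} a (λ j k<j → deg (suc j) (s≤s k<j)) i k≤i

÷[t-]-≈[] : ∀ p a → p ÷[t- a ] ≈ₚ [] → eval p a ≡ 0ℚ → p ≈ₚ []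
÷[t-]-≈[] []      a _     _      i       = refl
÷[t-]-≈[] (c ∷ p) a q≈0 p[a]≡0 zero    = begin
  c                  ≡⟨ solve (c ∷ a ∷ []) ℚ-ring ⟩
  c + a * 0ℚ         ≡⟨ cong (λ y → c + a * y) (sym (q≈0 0)) ⟩
  c + a * eval p a   ≡⟨ p[a]≡0 ⟩
  0ℚ                 ∎
÷[t-]-≈[] (c ∷ p) a q≈0 p[a]≡0 (suc i) =
  ÷[t-]-≈[] p a (λ j → q≈0 (suc j)) (q≈0 0) i

fromℕ : ℕ → ℚ
fromℕ j = fromℤ (ℤ.+ j)

fromℕ-injective : ∀ {i j} → fromℕ i ≡ fromℕ j → i ≡ j
fromℕ-injective eq = ℤP.+-injective (cong ↥_ eq)

vanishing-below⇒≈[] : ∀ k p → DegreeBelow p k →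
                          (∀ j → j ℕ.< k → eval p (fromℕ j) ≡ 0ℚ) → p ≈ₚ []
vanishing-below⇒≈[] zero    p deg _     i = deg i z≤n
vanishing-below⇒≈[] (suc k) p deg roots =
  ÷[t-]-≈[] p (fromℕ k) (vanishing-below⇒≈[] k (p ÷[t- fromℕ k ]) (÷[t-]-degree p (fromℕ k) deg) q-roots)
                       (roots k ℕP.≤-refl)
  where
  q-roots : ∀ j → j ℕ.< k → eval (p ÷[t- fromℕ k ]) (fromℕ j) ≡ 0ℚ
  q-roots j j<k = *-cancelˡ-≡0 j-k≢0 (begin
    (fromℕ j - fromℕ k) * eval (p ÷[t- fromℕ k ]) (fromℕ j)
      ≡⟨ sym (ℚP.+-identityˡ _) ⟩
    0ℚ + (fromℕ j - fromℕ k) * eval (p ÷[t- fromℕ k ]) (fromℕ j)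
      ≡⟨ cong (_+ (fromℕ j - fromℕ k) * eval (p ÷[t- fromℕ k ]) (fromℕ j)) (sym (roots k ℕP.≤-refl)) ⟩
    eval p (fromℕ k) + (fromℕ j - fromℕ k) * eval (p ÷[t- fromℕ k ]) (fromℕ j)
      ≡⟨ sym (eval-÷[t-] p (fromℕ k) (fromℕ j)) ⟩
    eval p (fromℕ j)
      ≡⟨ roots j (ℕP.m<n⇒m<1+n j<k) ⟩
    0ℚ ∎)
    where
    j-k≢0 : fromℕ j - fromℕ k ≢ 0ℚ
    j-k≢0 eq = ℕP.<⇒≢ j<k (fromℕ-injective (p-q≡0⇒p≡q eq))

eval≡0⇒≈[] : ∀ p → (∀ x → eval p x ≡ 0ℚ) → p ≈ₚ []
eval≡0⇒≈[] p p≡0 = vanishing-below⇒≈[] (length p) p (coeff-beyond-length p) (λ j _ → p≡0 (fromℕ j))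

eval-injective : ∀ p q → (∀ x → eval p x ≡ eval q x) → p ≈ₚ q
eval-injective p q p≡q i = p-q≡0⇒p≡q (begin
  coeff p i - coeff q i  ≡⟨ sym (coeff-diff p q i) ⟩
  coeff (p -ₚ q) i       ≡⟨ eval≡0⇒≈[] (p -ₚ q) (λ x → trans (eval-diff p q x) (p≡q⇒p-q≡0 (p≡q x))) i ⟩
  0ℚ                     ∎)

≈ₚ-trans : ∀ p q r → p ≈ₚ q → q ≈ₚ r → p ≈ₚ r
≈ₚ-trans p q r p≈q q≈r i = trans (p≈q i) (q≈r i)

tabulateₚ : ℕ → (ℕ → ℚ) → Poly
tabulateₚ zero    c = []
tabulateₚ (suc k) c = c 0 ∷ tabulateₚ k (λ i → c (suc i))

≈ₚ-tabulate : ∀ p k → DegreeBelow p k → p ≈ₚ tabulateₚ k (coeff p)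
≈ₚ-tabulate p k = go k (coeff p)
  where
  go : ∀ k c → (∀ i → k ℕ.≤ i → c i ≡ 0ℚ) → ∀ i → c i ≡ coeff (tabulateₚ k c) i
  go zero    c c≡0 i       = c≡0 i z≤n
  go (suc k) c c≡0 zero    = refl
  go (suc k) c c≡0 (suc i) = go k (λ j → c (suc j)) (λ j k≤j → c≡0 (suc j) (s≤s k≤j)) i

zero-or-degree : ∀ p → p ≈ₚ [] ⊎ ∃[ n ] HasDegree p n
zero-or-degree []      = inj₁ (λ _ → refl)
zero-or-degree (a ∷ p) with zero-or-degree p
... | inj₂ (n , lc≢0 , deg) = inj₂ (suc n , lc≢0 , λ { zero () ; (suc i) (s≤s n<i) → deg i n<i })
... | inj₁ p≈0 with a ℚP.≟ 0ℚ
...   | yes a≡0 = inj₁ (λ { zero → a≡0 ; (suc i) → p≈0 i })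
...   | no  a≢0 = inj₂ (0 , a≢0 , λ { zero () ; (suc i) _ → p≈0 i })

degree-unique : ∀ p {m n} → HasDegree p m → HasDegree p n → m ≡ n
degree-unique p {m} {n} (lcₘ≢0 , degₘ) (lcₙ≢0 , degₙ) with ℕP.<-cmp m n
... | tri< m<n _ _ = contradiction (degₘ n m<n) lcₙ≢0
... | tri≈ _ m≡n _ = m≡n
... | tri> _ _ n<m = contradiction (degₙ m n<m) lcₘ≢0

degree-resp-≈ : ∀ p q {n} → p ≈ₚ q → HasDegree p n → HasDegree q n
degree-resp-≈ p q {n} p≈q (lc≢0 , deg) =
  (λ lc≡0 → lc≢0 (trans (p≈q n) lc≡0)) , (λ i n<i → trans (sym (p≈q i)) (deg i n<i))

const-degree : ∀ {a} → a ≢ 0ℚ → HasDegree (const a) 0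
const-degree a≢0 = a≢0 , λ { zero () ; (suc i) _ → refl }

affine-degree : ∀ {α} β → α ≢ 0ℚ → HasDegree (affine α β) 1
affine-degree β α≢0 = α≢0 , λ { zero () ; (suc zero) (s≤s ()) ; (suc (suc i)) _ → refl }

quadratic-degree : ∀ {a} c b → a ≢ 0ℚ → HasDegree (c ∷ b ∷ a ∷ []) 2
quadratic-degree c b a≢0 =
  a≢0 , λ { zero () ; (suc zero) (s≤s ()) ; (suc (suc zero)) (s≤s (s≤s ())) ; (suc (suc (suc i))) _ → refl }

a*0+b≡b : ∀ a b → a * 0ℚ + b ≡ b
a*0+b≡b = solve-∀ ℚ-ring

coeff-∷*ₚ : ∀ a p q i → coeff ((a ∷ p) *ₚ q) i ≡ a * coeff q i + coeff (0ℚ ∷ p *ₚ q) i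
coeff-∷*ₚ a p q i =
  trans (coeff-+ₚ (scale a q) (0ℚ ∷ p *ₚ q) i) (cong (_+ coeff (0ℚ ∷ p *ₚ q) i) (coeff-scale a q i))

*ₚ-zeroˡ : ∀ p q → p ≈ₚ [] → p *ₚ q ≈ₚ []
*ₚ-zeroˡ p q p≈0 = eval≡0⇒≈[] (p *ₚ q) λ x → begin
  eval (p *ₚ q) x        ≡⟨ eval-*ₚ p q x ⟩
  eval p x * eval q x    ≡⟨ cong (_* eval q x) (eval-≈[] p p≈0 x) ⟩
  0ℚ * eval q x          ≡⟨ ℚP.*-zeroˡ (eval q x) ⟩
  0ℚ                     ∎

*ₚ-zeroʳ : ∀ p q → q ≈ₚ [] → p *ₚ q ≈ₚ []
*ₚ-zeroʳ p q q≈0 = eval≡0⇒≈[] (p *ₚ q) λ x → begin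
  eval (p *ₚ q) x        ≡⟨ eval-*ₚ p q x ⟩
  eval p x * eval q x    ≡⟨ cong (eval p x *_) (eval-≈[] q q≈0 x) ⟩
  eval p x * 0ℚ          ≡⟨ ℚP.*-zeroʳ (eval p x) ⟩
  0ℚ                     ∎

*ₚ-leading : ∀ p q m n → DegreeBelow p (suc m) → DegreeBelow q (suc n) →
             DegreeBelow (p *ₚ q) (suc (m ℕ.+ n)) × coeff (p *ₚ q) (m ℕ.+ n) ≡ coeff p m * coeff q n
*ₚ-leading []      q m       n _    _    = (λ _ _ → refl) , sym (ℚP.*-zeroˡ (coeff q n))
*ₚ-leading (a ∷ p) q zero    n degp degq = bound , leading
  where
  tail≈0 : (0ℚ ∷ p *ₚ q) ≈ₚ []
  tail≈0 zero    = refl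
  tail≈0 (suc i) = *ₚ-zeroˡ p q (λ j → degp (suc j) (s≤s z≤n)) i
  bound : DegreeBelow ((a ∷ p) *ₚ q) (suc n)
  bound i n<i = trans (coeff-∷*ₚ a p q i)
    (trans (cong₂ (λ y z → a * y + z) (degq i n<i) (tail≈0 i)) (a*0+b≡b a 0ℚ))
  leading : coeff ((a ∷ p) *ₚ q) n ≡ a * coeff q n
  leading = trans (coeff-∷*ₚ a p q n)
    (trans (cong (a * coeff q n +_) (tail≈0 n)) (ℚP.+-identityʳ (a * coeff q n)))
*ₚ-leading (a ∷ p) q (suc m) n degp degq = bound , leading
  where
  ih : DegreeBelow (p *ₚ q) (suc (m ℕ.+ n)) × coeff (p *ₚ q) (m ℕ.+ n) ≡ coeff p m * coeff q n
  ih = *ₚ-leading p q m n (λ i m<i → degp (suc i) (s≤s m<i)) degq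
  bound : DegreeBelow ((a ∷ p) *ₚ q) (suc (suc (m ℕ.+ n)))
  bound (suc i) (s≤s m+n<i) = trans (coeff-∷*ₚ a p q (suc i))
    (trans (cong₂ (λ y z → a * y + z) (degq (suc i) n<1+i) (proj₁ ih i m+n<i)) (a*0+b≡b a 0ℚ))
    where
    n<1+i : n ℕ.< suc i
    n<1+i = s≤s (ℕP.≤-trans (ℕP.m≤n+m n m) (ℕP.<⇒≤ m+n<i))
  leading : coeff ((a ∷ p) *ₚ q) (suc (m ℕ.+ n)) ≡ coeff p m * coeff q n
  leading = trans (coeff-∷*ₚ a p q (suc (m ℕ.+ n)))
    (trans (cong (a * coeff q (suc (m ℕ.+ n)) +_) (proj₂ ih))
    (trans (cong (λ y → a * y + coeff p m * coeff q n) (degq (suc (m ℕ.+ n)) (s≤s (ℕP.m≤n+m n m))))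
           (a*0+b≡b a (coeff p m * coeff q n))))

*ₚ-degree : ∀ p q {m n} → HasDegree p m → HasDegree q n → HasDegree (p *ₚ q) (m ℕ.+ n)
*ₚ-degree p q {m} {n} (lcp≢0 , degp) (lcq≢0 , degq) =
  subst (_≢ 0ℚ) (sym (proj₂ leading)) (*-≢0 lcp≢0 lcq≢0) , proj₁ leading
  where
  leading : DegreeBelow (p *ₚ q) (suc (m ℕ.+ n)) × coeff (p *ₚ q) (m ℕ.+ n) ≡ coeff p m * coeff q n
  leading = *ₚ-leading p q m n degp degq

∘ₚ-≈[] : ∀ p h → p ≈ₚ [] → p ∘ₚ h ≈ₚ []
∘ₚ-≈[] p h p≈0 = eval≡0⇒≈[] (p ∘ₚ h) λ x → trans (eval-∘ₚ p h x) (eval-≈[] p p≈0 (eval h x))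

const+ₚ-degree : ∀ a p {n} → HasDegree p (suc n) → HasDegree (const a +ₚ p) (suc n)
const+ₚ-degree a p {n} (lc≢0 , deg) =
  (λ lc≡0 → lc≢0 (trans (sym (shift n)) lc≡0)) , λ { zero () ; (suc i) n<i → trans (shift i) (deg (suc i) n<i) }
  where
  shift : ∀ i → coeff (const a +ₚ p) (suc i) ≡ coeff p (suc i)
  shift i = trans (coeff-+ₚ (const a) p (suc i)) (ℚP.+-identityˡ (coeff p (suc i)))

∘ₚ-degree : ∀ p h {m n} → HasDegree p m → HasDegree h (suc n) → HasDegree (p ∘ₚ h) (m ℕ.* suc n)
∘ₚ-degree []      h         (lc≢0 , _) _ = ⊥-elim (lc≢0 refl)
∘ₚ-degree (a ∷ p) h {zero}  (a≢0 , deg) _ = degree-resp-≈ (const a) ((a ∷ p) ∘ₚ h) collapse (const-degree a≢0)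
  where
  collapse : const a ≈ₚ (a ∷ p) ∘ₚ h
  collapse = eval-injective (const a) ((a ∷ p) ∘ₚ h) λ x → sym (begin
    eval ((a ∷ p) ∘ₚ h) x              ≡⟨ eval-∘ₚ (a ∷ p) h x ⟩
    a + eval h x * eval p (eval h x)   ≡⟨ cong (λ y → a + eval h x * y) (eval-≈[] p (λ i → deg (suc i) (s≤s z≤n)) (eval h x)) ⟩
    a + eval h x * 0ℚ                  ≡⟨ cong (a +_) (trans (ℚP.*-zeroʳ (eval h x)) (sym (ℚP.*-zeroʳ x))) ⟩
    a + x * 0ℚ                         ∎)
∘ₚ-degree (a ∷ p) h {suc m} (lc≢0 , deg) h-deg =
  const+ₚ-degree a (h *ₚ (p ∘ₚ h))
    (*ₚ-degree h (p ∘ₚ h) h-deg (∘ₚ-degree p h (lc≢0 , λ i m<i → deg (suc i) (s≤s m<i)) h-deg))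

∣ₚ-by-eval : ∀ p q r → (∀ x → eval q x ≡ eval p x * eval r x) → p ∣ₚ q
∣ₚ-by-eval p q r q≡pr = r , eval-injective (p *ₚ r) q λ x → trans (eval-*ₚ p r x) (sym (q≡pr x))

∣ₚ-eval : ∀ p q r → p *ₚ r ≈ₚ q → ∀ x → eval q x ≡ eval p x * eval r x
∣ₚ-eval p q r pr≈q x = trans (sym (eval-cong (p *ₚ r) q pr≈q x)) (eval-*ₚ p r x)

∣ₚ-resp-≈ : ∀ p p' q q' → p ≈ₚ p' → q ≈ₚ q' → p ∣ₚ q → p' ∣ₚ q'
∣ₚ-resp-≈ p p' q q' p≈p' q≈q' (r , pr≈q) = ∣ₚ-by-eval p' q' r λ x → begin
  eval q' x             ≡⟨ sym (eval-cong q q' q≈q' x) ⟩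
  eval q x              ≡⟨ ∣ₚ-eval p q r pr≈q x ⟩
  eval p x * eval r x   ≡⟨ cong (_* eval r x) (eval-cong p p' p≈p' x) ⟩
  eval p' x * eval r x  ∎

∣ₚ-∘ₚ : ∀ p q h → p ∣ₚ q → p ∘ₚ h ∣ₚ q ∘ₚ h
∣ₚ-∘ₚ p q h (r , pr≈q) = ∣ₚ-by-eval (p ∘ₚ h) (q ∘ₚ h) (r ∘ₚ h) λ x → begin
  eval (q ∘ₚ h) x                             ≡⟨ eval-∘ₚ q h x ⟩
  eval q (eval h x)                           ≡⟨ ∣ₚ-eval p q r pr≈q (eval h x) ⟩
  eval p (eval h x) * eval r (eval h x)       ≡⟨ sym (cong₂ _*_ (eval-∘ₚ p h x) (eval-∘ₚ r h x)) ⟩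
  eval (p ∘ₚ h) x * eval (r ∘ₚ h) x           ∎

*ₚ-∣ₚˡ : ∀ p q s → p *ₚ q ∣ₚ s → p ∣ₚ s
*ₚ-∣ₚˡ p q s (r , pqr≈s) = ∣ₚ-by-eval p s (q *ₚ r) λ x → begin
  eval s x                              ≡⟨ ∣ₚ-eval (p *ₚ q) s r pqr≈s x ⟩
  eval (p *ₚ q) x * eval r x            ≡⟨ cong (_* eval r x) (eval-*ₚ p q x) ⟩
  eval p x * eval q x * eval r x        ≡⟨ ℚP.*-assoc (eval p x) (eval q x) (eval r x) ⟩
  eval p x * (eval q x * eval r x)      ≡⟨ cong (eval p x *_) (sym (eval-*ₚ q r x)) ⟩
  eval p x * eval (q *ₚ r) x            ∎

*ₚ-∣ₚʳ : ∀ p q s → p *ₚ q ∣ₚ s → q ∣ₚ s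
*ₚ-∣ₚʳ p q s pq∣s = *ₚ-∣ₚˡ q p s (∣ₚ-resp-≈ (p *ₚ q) (q *ₚ p) s s pq≈qp (λ _ → refl) pq∣s)
  where
  pq≈qp : p *ₚ q ≈ₚ q *ₚ p
  pq≈qp = eval-injective (p *ₚ q) (q *ₚ p) λ x →
    trans (eval-*ₚ p q x) (trans (ℚP.*-comm (eval p x) (eval q x)) (sym (eval-*ₚ q p x)))

infix 4 _≡_[mod_]
_≡_[mod_] : Poly → Poly → Poly → Set
p ≡ q [mod d ] = d ∣ₚ p -ₚ q

mod-by-eval : ∀ p q d r → (∀ x → eval p x - eval q x ≡ eval d x * eval r x) → p ≡ q [mod d ]
mod-by-eval p q d r p-q≡dr = ∣ₚ-by-eval d (p -ₚ q) r λ x → trans (eval-diff p q x) (p-q≡dr x)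

mod-eval : ∀ p q d r → d *ₚ r ≈ₚ p -ₚ q → ∀ x → eval p x - eval q x ≡ eval d x * eval r x
mod-eval p q d r dr≈p-q x = trans (sym (eval-diff p q x)) (∣ₚ-eval d (p -ₚ q) r dr≈p-q x)

mod-refl : ∀ p d → p ≡ p [mod d ]
mod-refl p d = mod-by-eval p p d [] λ x → trans (ℚP.+-inverseʳ (eval p x)) (sym (ℚP.*-zeroʳ (eval d x)))

mod-+ₚ : ∀ a b c e d → a ≡ b [mod d ] → c ≡ e [mod d ] → a +ₚ c ≡ b +ₚ e [mod d ]
mod-+ₚ a b c e d (r , a-b≈dr) (s , c-e≈ds) = mod-by-eval (a +ₚ c) (b +ₚ e) d (r +ₚ s) λ x → begin
  eval (a +ₚ c) x - eval (b +ₚ e) x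
    ≡⟨ cong₂ _-_ (eval-+ₚ a c x) (eval-+ₚ b e x) ⟩
  (eval a x + eval c x) - (eval b x + eval e x)
    ≡⟨ regroup (eval a x) (eval b x) (eval c x) (eval e x) ⟩
  (eval a x - eval b x) + (eval c x - eval e x)
    ≡⟨ cong₂ _+_ (mod-eval a b d r a-b≈dr x) (mod-eval c e d s c-e≈ds x) ⟩
  eval d x * eval r x + eval d x * eval s x
    ≡⟨ sym (trans (cong (eval d x *_) (eval-+ₚ r s x)) (ℚP.*-distribˡ-+ (eval d x) (eval r x) (eval s x))) ⟩
  eval d x * eval (r +ₚ s) x ∎
  where
  regroup : ∀ a b c e → (a + c) - (b + e) ≡ (a - b) + (c - e)
  regroup = solve-∀ ℚ-ring

mod-*ₚ : ∀ a b c e d → a ≡ b [mod d ] → c ≡ e [mod d ] → a *ₚ c ≡ b *ₚ e [mod d ]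
mod-*ₚ a b c e d (r , a-b≈dr) (s , c-e≈ds) = mod-by-eval (a *ₚ c) (b *ₚ e) d (r *ₚ c +ₚ b *ₚ s) λ x → begin
  eval (a *ₚ c) x - eval (b *ₚ e) x
    ≡⟨ cong₂ _-_ (eval-*ₚ a c x) (eval-*ₚ b e x) ⟩
  eval a x * eval c x - eval b x * eval e x
    ≡⟨ regroup (eval a x) (eval b x) (eval c x) (eval e x) ⟩
  (eval a x - eval b x) * eval c x + eval b x * (eval c x - eval e x)
    ≡⟨ cong₂ (λ y z → y * eval c x + eval b x * z) (mod-eval a b d r a-b≈dr x) (mod-eval c e d s c-e≈ds x) ⟩
  eval d x * eval r x * eval c x + eval b x * (eval d x * eval s x)
    ≡⟨ factor (eval d x) (eval r x) (eval c x) (eval b x) (eval s x) ⟩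
  eval d x * (eval r x * eval c x + eval b x * eval s x)
    ≡⟨ cong (eval d x *_) (sym (trans (eval-+ₚ (r *ₚ c) (b *ₚ s) x) (cong₂ _+_ (eval-*ₚ r c x) (eval-*ₚ b s x)))) ⟩
  eval d x * eval (r *ₚ c +ₚ b *ₚ s) x ∎
  where
  regroup : ∀ a b c e → a * c - b * e ≡ (a - b) * c + b * (c - e)
  regroup = solve-∀ ℚ-ring
  factor : ∀ d r c b s → d * r * c + b * (d * s) ≡ d * (r * c + b * s)
  factor = solve-∀ ℚ-ring

mod-cube : ∀ a b d → a ≡ b [mod d ] → cube a ≡ cube b [mod d ]
mod-cube a b d a≡b = mod-*ₚ (a *ₚ a) (b *ₚ b) a b d (mod-*ₚ a b a b d a≡b a≡b) a≡b

mod-∣ₚ : ∀ a b d → a ≡ b [mod d ] → d ∣ₚ a → d ∣ₚ b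
mod-∣ₚ a b d (r , a-b≈dr) (s , ds≈a) = ∣ₚ-by-eval d b (s -ₚ r) λ x → begin
  eval b x                                  ≡⟨ regroup (eval a x) (eval b x) ⟩
  eval a x - (eval a x - eval b x)          ≡⟨ cong₂ _-_ (∣ₚ-eval d a s ds≈a x) (mod-eval a b d r a-b≈dr x) ⟩
  eval d x * eval s x - eval d x * eval r x ≡⟨ sym (trans (cong (eval d x *_) (eval-diff s r x)) (distrib (eval d x) (eval s x) (eval r x))) ⟩
  eval d x * eval (s -ₚ r) x                ∎
  where
  regroup : ∀ a b → b ≡ a - (a - b)
  regroup = solve-∀ ℚ-ring
  distrib : ∀ d s r → d * (s - r) ≡ d * s - d * r
  distrib = solve-∀ ℚ-ring

-- Quadratic factors of t³ - w³

-- The hypotheses are the coefficients of (c + bt + at²)(r₀ + r₁t) = t³ - w³.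
cube-root-of-factorisation : ∀ a b c r₀ r₁ w →
  a * r₁ ≡ 1ℚ → b * r₁ + a * r₀ ≡ 0ℚ → c * r₁ + b * r₀ ≡ 0ℚ → c * r₀ ≡ - (w * w * w) →
  b ≡ w * a × c ≡ w * w * a
cube-root-of-factorisation a b c r₀ r₁ w ar₁≡1 e₂ e₁ e₀ = b≡wa , c≡wwa
  where
  unit : ∀ x → x ≡ x * (a * r₁)
  unit x = trans (sym (ℚP.*-identityʳ x)) (cong (x *_) (sym ar₁≡1))
  r₀≡ : r₀ ≡ - (b * r₁ * r₁)
  r₀≡ = begin
    r₀                 ≡⟨ unit r₀ ⟩
    r₀ * (a * r₁)      ≡⟨ solve (r₀ ∷ a ∷ r₁ ∷ []) ℚ-ring ⟩
    r₁ * (a * r₀)      ≡⟨ cong (r₁ *_) (inverseʳ-unique (b * r₁) (a * r₀) e₂) ⟩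
    r₁ * - (b * r₁)    ≡⟨ solve (r₁ ∷ b ∷ []) ℚ-ring ⟩
    - (b * r₁ * r₁)    ∎
  c≡ : c ≡ b * r₁ * (b * r₁) * a
  c≡ = begin
    c                               ≡⟨ unit c ⟩
    c * (a * r₁)                    ≡⟨ solve (c ∷ a ∷ r₁ ∷ []) ℚ-ring ⟩
    a * (c * r₁)                    ≡⟨ cong (a *_) (inverseˡ-unique (c * r₁) (b * r₀) e₁) ⟩
    a * - (b * r₀)                  ≡⟨ cong (λ y → a * - (b * y)) r₀≡ ⟩
    a * - (b * - (b * r₁ * r₁))     ≡⟨ solve (a ∷ b ∷ r₁ ∷ []) ℚ-ring ⟩
    b * r₁ * (b * r₁) * a           ∎
  u³≡w³ : b * r₁ * (b * r₁) * (b * r₁) ≡ w * w * w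
  u³≡w³ = ℚP.neg-injective (begin
    - (b * r₁ * (b * r₁) * (b * r₁))                  ≡⟨ cong -_ (unit _) ⟩
    - (b * r₁ * (b * r₁) * (b * r₁) * (a * r₁))       ≡⟨ solve (a ∷ b ∷ r₁ ∷ []) ℚ-ring ⟩
    b * r₁ * (b * r₁) * a * - (b * r₁ * r₁)           ≡⟨ sym (cong₂ _*_ c≡ r₀≡) ⟩
    c * r₀                                            ≡⟨ e₀ ⟩
    - (w * w * w)                                     ∎)
  u≡w : b * r₁ ≡ w
  u≡w = cube-injective u³≡w³
  b≡wa : b ≡ w * a
  b≡wa = begin
    b                ≡⟨ unit b ⟩
    b * (a * r₁)     ≡⟨ solve (a ∷ b ∷ r₁ ∷ []) ℚ-ring ⟩
    b * r₁ * a       ≡⟨ cong (_* a) u≡w ⟩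
    w * a            ∎
  c≡wwa : c ≡ w * w * a
  c≡wwa = trans c≡ (cong (λ u → u * u * a) u≡w)

cube-X+const : ∀ c → cube X +ₚ const c ≈ₚ (c ∷ 0ℚ ∷ 0ℚ ∷ 1ℚ ∷ [])
cube-X+const c = eval-injective (cube X +ₚ const c) (c ∷ 0ℚ ∷ 0ℚ ∷ 1ℚ ∷ []) λ x → begin
  eval (cube X +ₚ const c) x              ≡⟨ eval-+ₚ (cube X) (const c) x ⟩
  eval (cube X) x + (c + x * 0ℚ)          ≡⟨ cong (_+ (c + x * 0ℚ)) (eval-cube X x) ⟩
  eval X x * eval X x * eval X x + (c + x * 0ℚ) ≡⟨ expand c x ⟩
  eval (c ∷ 0ℚ ∷ 0ℚ ∷ 1ℚ ∷ []) x          ∎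
  where
  expand : ∀ c x → let y = 0ℚ + x * (1ℚ + x * 0ℚ) in
           y * y * y + (c + x * 0ℚ) ≡ c + x * (0ℚ + x * (0ℚ + x * (1ℚ + x * 0ℚ)))
  expand = solve-∀ ℚ-ring

quadratic-factor-of-cube-difference : ∀ q w → HasDegree q 2 → q ∣ₚ cube X +ₚ const (- (w * w * w)) →
                                      q ≈ₚ scale (coeff q 2) (w * w ∷ w ∷ 1ℚ ∷ [])
quadratic-factor-of-cube-difference q w (a≢0 , q-deg) (r , qr≈P) = q≈
  where
  P = - (w * w * w) ∷ 0ℚ ∷ 0ℚ ∷ 1ℚ ∷ []
  qr≈P′ : q *ₚ r ≈ₚ P
  qr≈P′ = ≈ₚ-trans (q *ₚ r) (cube X +ₚ const (- (w * w * w))) P qr≈P (cube-X+const (- (w * w * w)))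
  P-degree : HasDegree P 3
  P-degree = ℚP.1≢0 , λ { zero () ; (suc zero) (s≤s ()) ; (suc (suc zero)) (s≤s (s≤s ())) ;
                          (suc (suc (suc zero))) (s≤s (s≤s (s≤s ()))) ; (suc (suc (suc (suc i)))) _ → refl }
  r-degree : HasDegree r 1
  r-degree with zero-or-degree r
  ... | inj₁ r≈0 = ⊥-elim (ℚP.1≢0 (trans (sym (qr≈P′ 3)) (*ₚ-zeroʳ q r r≈0 3)))
  ... | inj₂ (m , r-deg) = subst (HasDegree r) (ℕP.+-cancelˡ-≡ 2 m 1 2+m≡3) r-deg
    where
    2+m≡3 : 2 ℕ.+ m ≡ 3
    2+m≡3 = degree-unique P (degree-resp-≈ (q *ₚ r) P qr≈P′ (*ₚ-degree q r (a≢0 , q-deg) r-deg)) P-degree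
  c = coeff q 0
  b = coeff q 1
  a = coeff q 2
  r₀ = coeff r 0
  r₁ = coeff r 1
  product : (c * r₀ ∷ c * r₁ + b * r₀ ∷ b * r₁ + a * r₀ ∷ a * r₁ ∷ []) ≈ₚ P
  product = eval-injective (c * r₀ ∷ c * r₁ + b * r₀ ∷ b * r₁ + a * r₀ ∷ a * r₁ ∷ []) P λ x → begin
    c * r₀ + x * (c * r₁ + b * r₀ + x * (b * r₁ + a * r₀ + x * (a * r₁ + x * 0ℚ)))
      ≡⟨ expand c b a r₀ r₁ x ⟩
    eval (c ∷ b ∷ a ∷ []) x * eval (r₀ ∷ r₁ ∷ []) x
      ≡⟨ sym (cong₂ _*_ (eval-cong q (c ∷ b ∷ a ∷ []) (≈ₚ-tabulate q 3 q-deg) x)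
                       (eval-cong r (r₀ ∷ r₁ ∷ []) (≈ₚ-tabulate r 2 (proj₂ r-degree)) x)) ⟩
    eval q x * eval r x
      ≡⟨ sym (eval-*ₚ q r x) ⟩
    eval (q *ₚ r) x
      ≡⟨ eval-cong (q *ₚ r) P qr≈P′ x ⟩
    eval P x ∎
    where
    expand : ∀ c b a r₀ r₁ x →
      c * r₀ + x * (c * r₁ + b * r₀ + x * (b * r₁ + a * r₀ + x * (a * r₁ + x * 0ℚ)))
      ≡ (c + x * (b + x * (a + x * 0ℚ))) * (r₀ + x * (r₁ + x * 0ℚ))
    expand = solve-∀ ℚ-ring
  relations : b ≡ w * a × c ≡ w * w * a
  relations = cube-root-of-factorisation a b c r₀ r₁ w (product 3) (product 2) (product 1) (product 0)
  q≈ : q ≈ₚ scale a (w * w ∷ w ∷ 1ℚ ∷ [])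
  q≈ zero                      = trans (proj₂ relations) (ℚP.*-comm (w * w) a)
  q≈ (suc zero)                = trans (proj₁ relations) (ℚP.*-comm w a)
  q≈ (suc (suc zero))          = sym (ℚP.*-identityʳ a)
  q≈ (suc (suc (suc i)))       = q-deg (suc (suc (suc i))) (s≤s (s≤s (s≤s z≤n)))

-- The divisibility fg ∣ f³ + g³ + 8

cubes+8 : Poly → Poly → Poly
cubes+8 f g = cube f +ₚ cube g +ₚ const eight

eval-cubes+8 : ∀ f g x → eval (cubes+8 f g) x ≡
               eval f x * eval f x * eval f x + eval g x * eval g x * eval g x + eight
eval-cubes+8 f g x = begin
  eval (cube f +ₚ cube g +ₚ const eight) x
    ≡⟨ eval-+ₚ (cube f +ₚ cube g) (const eight) x ⟩
  eval (cube f +ₚ cube g) x + (eight + x * 0ℚ)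
    ≡⟨ cong₂ _+_ (trans (eval-+ₚ (cube f) (cube g) x) (cong₂ _+_ (eval-cube f x) (eval-cube g x)))
                 (trans (cong (eight +_) (ℚP.*-zeroʳ x)) (ℚP.+-identityʳ eight)) ⟩
  eval f x * eval f x * eval f x + eval g x * eval g x * eval g x + eight ∎

mod-self : ∀ d → d ≡ [] [mod d ]
mod-self d = mod-by-eval d [] d (const 1ℚ) λ x → identity (eval d x) x
  where
  identity : ∀ y x → y - 0ℚ ≡ y * (1ℚ + x * 0ℚ)
  identity = solve-∀ ℚ-ring

mod-cubes+8 : ∀ a a′ b b′ d → a ≡ a′ [mod d ] → b ≡ b′ [mod d ] → cubes+8 a b ≡ cubes+8 a′ b′ [mod d ]
mod-cubes+8 a a′ b b′ d a≡a′ b≡b′ =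
  mod-+ₚ (cube a +ₚ cube b) (cube a′ +ₚ cube b′) (const eight) (const eight) d
    (mod-+ₚ (cube a) (cube a′) (cube b) (cube b′) d (mod-cube a a′ d a≡a′) (mod-cube b b′ d b≡b′))
    (mod-refl (const eight) d)

divisibility-∘ₚ : ∀ f g h → f *ₚ g ∣ₚ cubes+8 f g → f ∘ₚ h *ₚ g ∘ₚ h ∣ₚ cubes+8 (f ∘ₚ h) (g ∘ₚ h)
divisibility-∘ₚ f g h fg∣ =
  ∣ₚ-resp-≈ ((f *ₚ g) ∘ₚ h) (f ∘ₚ h *ₚ g ∘ₚ h) (cubes+8 f g ∘ₚ h) (cubes+8 (f ∘ₚ h) (g ∘ₚ h))
    product-∘ₚ cubes-∘ₚ (∣ₚ-∘ₚ (f *ₚ g) (cubes+8 f g) h fg∣)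
  where
  product-∘ₚ : (f *ₚ g) ∘ₚ h ≈ₚ f ∘ₚ h *ₚ g ∘ₚ h
  product-∘ₚ = eval-injective ((f *ₚ g) ∘ₚ h) (f ∘ₚ h *ₚ g ∘ₚ h) λ x → begin
    eval ((f *ₚ g) ∘ₚ h) x                  ≡⟨ eval-∘ₚ (f *ₚ g) h x ⟩
    eval (f *ₚ g) (eval h x)                ≡⟨ eval-*ₚ f g (eval h x) ⟩
    eval f (eval h x) * eval g (eval h x)   ≡⟨ sym (cong₂ _*_ (eval-∘ₚ f h x) (eval-∘ₚ g h x)) ⟩
    eval (f ∘ₚ h) x * eval (g ∘ₚ h) x       ≡⟨ sym (eval-*ₚ (f ∘ₚ h) (g ∘ₚ h) x) ⟩
    eval (f ∘ₚ h *ₚ g ∘ₚ h) x               ∎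
  cubes-∘ₚ : cubes+8 f g ∘ₚ h ≈ₚ cubes+8 (f ∘ₚ h) (g ∘ₚ h)
  cubes-∘ₚ = eval-injective (cubes+8 f g ∘ₚ h) (cubes+8 (f ∘ₚ h) (g ∘ₚ h)) λ x → begin
    eval (cubes+8 f g ∘ₚ h) x    ≡⟨ eval-∘ₚ (cubes+8 f g) h x ⟩
    eval (cubes+8 f g) (eval h x) ≡⟨ eval-cubes+8 f g (eval h x) ⟩
    eval f (eval h x) * eval f (eval h x) * eval f (eval h x)
      + eval g (eval h x) * eval g (eval h x) * eval g (eval h x) + eight
      ≡⟨ sym (cong₂ (λ u v → u * u * u + v * v * v + eight) (eval-∘ₚ f h x) (eval-∘ₚ g h x)) ⟩
    eval (f ∘ₚ h) x * eval (f ∘ₚ h) x * eval (f ∘ₚ h) x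
      + eval (g ∘ₚ h) x * eval (g ∘ₚ h) x * eval (g ∘ₚ h) x + eight
      ≡⟨ sym (eval-cubes+8 (f ∘ₚ h) (g ∘ₚ h) x) ⟩
    eval (cubes+8 (f ∘ₚ h) (g ∘ₚ h)) x ∎

-- The reduced equation

L≡1∧4A≡1 : ∀ L A → L ≢ 0ℚ → A ≢ 0ℚ →
           L * A * 4 ≡ L * L * L * A * (- 2 * - 2) → L * L * A * 2 - L ≡ L * L * L * A * - 2 →
           L ≡ 1ℚ × A * 4 ≡ 1ℚ
L≡1∧4A≡1 L A L≢0 A≢0 e₀ e₁ with 1ℚ - L ℚP.≟ 0ℚ
... | yes 1-L≡0 = L≡1 , (begin
  A * 4                                                  ≡⟨ identity A ⟩
  (1ℚ * 1ℚ * A * 2 - 1ℚ) - 1ℚ * 1ℚ * 1ℚ * A * - 2 + 1ℚ  ≡⟨ cong (_+ 1ℚ) (p≡q⇒p-q≡0 (subst E₁ L≡1 e₁)) ⟩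
  0ℚ + 1ℚ                                                ≡⟨ ℚP.+-identityˡ 1ℚ ⟩
  1ℚ                                                     ∎)
  where
  E₁ : ℚ → Set
  E₁ L = L * L * A * 2 - L ≡ L * L * L * A * - 2
  L≡1 : L ≡ 1ℚ
  L≡1 = sym (p-q≡0⇒p≡q 1-L≡0)
  identity : ∀ A → A * 4 ≡ (1ℚ * 1ℚ * A * 2 - 1ℚ) - 1ℚ * 1ℚ * 1ℚ * A * - 2 + 1ℚ
  identity = solve-∀ ℚ-ring
... | no 1-L≢0 = ⊥-elim (ℚP.1≢0 (begin
  1ℚ                                                           ≡⟨ identity A ⟩
  (- 1ℚ * - 1ℚ * A * 2 - - 1ℚ) - - 1ℚ * - 1ℚ * - 1ℚ * A * - 2  ≡⟨ p≡q⇒p-q≡0 (subst E₁ L≡-1 e₁) ⟩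
  0ℚ                                                           ∎))
  where
  1+L≡0 : 1ℚ + L ≡ 0ℚ
  1+L≡0 = *-cancelˡ-≡0 1-L≢0 (*-cancelˡ-≡0 (*-≢0 (*-≢0 L≢0 A≢0) (λ ())) (begin
    L * A * 4 * ((1ℚ - L) * (1ℚ + L))        ≡⟨ expand L A ⟩
    L * A * 4 - L * L * L * A * (- 2 * - 2)  ≡⟨ p≡q⇒p-q≡0 e₀ ⟩
    0ℚ                                       ∎))
    where
    expand : ∀ L A → L * A * 4 * ((1ℚ - L) * (1ℚ + L)) ≡ L * A * 4 - L * L * L * A * (- 2 * - 2)
    expand = solve-∀ ℚ-ring
  E₁ : ℚ → Set
  E₁ L = L * L * A * 2 - L ≡ L * L * L * A * - 2
  L≡-1 : L ≡ - 1ℚ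
  L≡-1 = inverseʳ-unique 1ℚ L 1+L≡0
  identity : ∀ A → 1ℚ ≡ (- 1ℚ * - 1ℚ * A * 2 - - 1ℚ) - - 1ℚ * - 1ℚ * - 1ℚ * A * - 2
  identity = solve-∀ ℚ-ring

eval-reduced : ∀ q g L → g ≈ₚ scale L q +ₚ X → ∀ x → eval g x ≡ L * eval q x + x
eval-reduced q g L g≈ x = begin
  eval g x                        ≡⟨ eval-cong g (scale L q +ₚ X) g≈ x ⟩
  eval (scale L q +ₚ X) x         ≡⟨ eval-+ₚ (scale L q) X x ⟩
  eval (scale L q) x + eval X x   ≡⟨ cong₂ _+_ (eval-scale L q x) (eval-X x) ⟩
  L * eval q x + x                ∎

-- Modulo q we have g ≡ t.
reduced-first-factor : ∀ q g L → g ≈ₚ scale L q +ₚ X → q *ₚ g ∣ₚ cubes+8 q g → q ∣ₚ cube X +ₚ const eight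
reduced-first-factor q g L g≈ qg∣ =
  mod-∣ₚ (cubes+8 q g) (cubes+8 [] X) q (mod-cubes+8 q [] g X q (mod-self q) g≡X) (*ₚ-∣ₚˡ q g (cubes+8 q g) qg∣)
  where
  g≡X : g ≡ X [mod q ]
  g≡X = mod-by-eval g X q (const L) λ x → begin
    eval g x - eval X x             ≡⟨ cong₂ _-_ (eval-reduced q g L g≈ x) (eval-X x) ⟩
    L * eval q x + x - x            ≡⟨ identity L (eval q x) x ⟩
    eval q x * (L + x * 0ℚ)         ∎
    where
    identity : ∀ L y x → L * y + x - x ≡ y * (L + x * 0ℚ)
    identity = solve-∀ ℚ-ring

rescale-cube : ∀ L .{{_ : NonZero L}} → cubes+8 (affine (- (1/ L)) 0ℚ) [] ∘ₚ affine (- L) 0ℚ ≈ₚ cube X +ₚ const eight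
rescale-cube L = eval-injective (cubes+8 (affine λ′ 0ℚ) [] ∘ₚ h) (cubes+8 [] X) λ x → begin
  eval (cubes+8 (affine λ′ 0ℚ) [] ∘ₚ h) x                ≡⟨ eval-∘ₚ (cubes+8 (affine λ′ 0ℚ) []) h x ⟩
  eval (cubes+8 (affine λ′ 0ℚ) []) (eval h x)            ≡⟨ eval-cubes+8 (affine λ′ 0ℚ) [] (eval h x) ⟩
  eval (affine λ′ 0ℚ) (eval h x) * eval (affine λ′ 0ℚ) (eval h x) * eval (affine λ′ 0ℚ) (eval h x)
    + 0ℚ * 0ℚ * 0ℚ + eight                               ≡⟨ cong (λ u → u * u * u + 0ℚ * 0ℚ * 0ℚ + eight) (λ[-Lx]≡x x) ⟩
  x * x * x + 0ℚ * 0ℚ * 0ℚ + eight                       ≡⟨ cong (_+ eight) (ℚP.+-comm (x * x * x) (0ℚ * 0ℚ * 0ℚ)) ⟩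
  0ℚ * 0ℚ * 0ℚ + x * x * x + eight                       ≡⟨ cong (λ u → 0ℚ * 0ℚ * 0ℚ + u * u * u + eight) (sym (eval-X x)) ⟩
  0ℚ * 0ℚ * 0ℚ + eval X x * eval X x * eval X x + eight  ≡⟨ sym (eval-cubes+8 [] X x) ⟩
  eval (cubes+8 [] X) x                                  ∎
  where
  λ′ = - (1/ L)
  h = affine (- L) 0ℚ
  λ[-Lx]≡x : ∀ x → eval (affine λ′ 0ℚ) (eval h x) ≡ x
  λ[-Lx]≡x x = begin
    0ℚ + (0ℚ + x * (- L + x * 0ℚ)) * (λ′ + (0ℚ + x * (- L + x * 0ℚ)) * 0ℚ) ≡⟨ identity x L (1/ L) ⟩
    x * (L * 1/ L)                                                         ≡⟨ cong (x *_) (ℚP.*-inverseʳ L) ⟩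
    x * 1ℚ                                                                 ≡⟨ ℚP.*-identityʳ x ⟩
    x                                                                      ∎
    where
    identity : ∀ x L l → 0ℚ + (0ℚ + x * (- L + x * 0ℚ)) * (- l + (0ℚ + x * (- L + x * 0ℚ)) * 0ℚ) ≡ x * (L * l)
    identity = solve-∀ ℚ-ring

-- Modulo g we have q ≡ -t/L.
reduced-second-factor : ∀ q g L .{{_ : NonZero L}} → g ≈ₚ scale L q +ₚ X → q *ₚ g ∣ₚ cubes+8 q g →
                        g ∘ₚ affine (- L) 0ℚ ∣ₚ cube X +ₚ const eight
reduced-second-factor q g L g≈ qg∣ =
  ∣ₚ-resp-≈ (g ∘ₚ h) (g ∘ₚ h) (cubes+8 (affine λ′ 0ℚ) [] ∘ₚ h) (cube X +ₚ const eight) (λ _ → refl) (rescale-cube L)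
    (∣ₚ-∘ₚ g (cubes+8 (affine λ′ 0ℚ) []) h
      (mod-∣ₚ (cubes+8 q g) (cubes+8 (affine λ′ 0ℚ) []) g (mod-cubes+8 q (affine λ′ 0ℚ) g [] g q≡λ′X (mod-self g))
              (*ₚ-∣ₚʳ q g (cubes+8 q g) qg∣)))
  where
  λ′ = - (1/ L)
  h = affine (- L) 0ℚ
  q≡λ′X : q ≡ affine λ′ 0ℚ [mod g ]
  q≡λ′X = mod-by-eval q (affine λ′ 0ℚ) g (const (1/ L)) λ x → begin
    eval q x - (0ℚ + x * (λ′ + x * 0ℚ))          ≡⟨ identity₁ (eval q x) x (1/ L) ⟩
    eval q x * 1ℚ + x * 1/ L                     ≡⟨ cong (λ y → eval q x * y + x * 1/ L) (sym (ℚP.*-inverseʳ L)) ⟩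
    eval q x * (L * 1/ L) + x * 1/ L             ≡⟨ identity₂ (eval q x) x L (1/ L) ⟩
    (L * eval q x + x) * (1/ L + x * 0ℚ)         ≡⟨ cong (_* (1/ L + x * 0ℚ)) (sym (eval-reduced q g L g≈ x)) ⟩
    eval g x * (1/ L + x * 0ℚ)                   ∎
    where
    identity₁ : ∀ y x l → y - (0ℚ + x * (- l + x * 0ℚ)) ≡ y * 1ℚ + x * l
    identity₁ = solve-∀ ℚ-ring
    identity₂ : ∀ y x L l → y * (L * l) + x * l ≡ (L * y + x) * (l + x * 0ℚ)
    identity₂ = solve-∀ ℚ-ring

t²-2t+4 : Poly
t²-2t+4 = - 2 * - 2 ∷ - 2 ∷ 1ℚ ∷ []

quarter-of-F[t/2] : ∀ q → coeff q 2 * 4 ≡ 1ℚ → q ≈ₚ scale (coeff q 2) t²-2t+4 →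
                    q ≈ₚ F ∘ₚ affine ½ 0ℚ
quarter-of-F[t/2] q 4A≡1 q≈ = eval-injective q (F ∘ₚ affine ½ 0ℚ) λ x → begin
  eval q x                                                  ≡⟨ eval-cong q (scale A t²-2t+4) q≈ x ⟩
  A * (- 2 * - 2) + x * (A * - 2 + x * (A * 1ℚ + x * 0ℚ))   ≡⟨ identity A x ⟩
  A * 4 * (1ℚ + (0ℚ + x * (½ + x * 0ℚ)) * (- 1ℚ + (0ℚ + x * (½ + x * 0ℚ)) * (1ℚ + (0ℚ + x * (½ + x * 0ℚ)) * 0ℚ)))
                                                            ≡⟨ cong (_* eval F (eval (affine ½ 0ℚ) x)) 4A≡1 ⟩
  1ℚ * eval F (eval (affine ½ 0ℚ) x)                        ≡⟨ ℚP.*-identityˡ (eval F (eval (affine ½ 0ℚ) x)) ⟩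
  eval F (eval (affine ½ 0ℚ) x)                             ≡⟨ sym (eval-∘ₚ F (affine ½ 0ℚ) x) ⟩
  eval (F ∘ₚ affine ½ 0ℚ) x                                 ∎
  where
  A = coeff q 2
  identity : ∀ A x → A * (- 2 * - 2) + x * (A * - 2 + x * (A * 1ℚ + x * 0ℚ))
    ≡ A * 4 * (1ℚ + (0ℚ + x * (½ + x * 0ℚ)) * (- 1ℚ + (0ℚ + x * (½ + x * 0ℚ)) * (1ℚ + (0ℚ + x * (½ + x * 0ℚ)) * 0ℚ)))
  identity = solve-∀ ℚ-ring

reduced-solution : ∀ q g L → HasDegree q 2 → L ≢ 0ℚ → g ≈ₚ scale L q +ₚ X →
                   q *ₚ g ∣ₚ cubes+8 q g → L ≡ 1ℚ × q ≈ₚ F ∘ₚ affine ½ 0ℚ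
reduced-solution q g L q-deg@(A≢0 , _) L≢0 g≈ qg∣ =
  proj₁ coefficients , quarter-of-F[t/2] q (proj₂ coefficients) q≈
  where
  instance _ = ≢-nonZero L≢0
  A = coeff q 2
  h = affine (- L) 0ℚ
  G′ = L * A * 4 ∷ L * L * A * 2 - L ∷ L * L * L * A ∷ []
  q≈ : q ≈ₚ scale A t²-2t+4
  q≈ = quadratic-factor-of-cube-difference q (- 2) q-deg (reduced-first-factor q g L g≈ qg∣)
  g∘h≈G′ : g ∘ₚ h ≈ₚ G′
  g∘h≈G′ = eval-injective (g ∘ₚ h) G′ λ x → begin
    eval (g ∘ₚ h) x                      ≡⟨ eval-∘ₚ g h x ⟩
    eval g (eval h x)                    ≡⟨ eval-reduced q g L g≈ (eval h x) ⟩
    L * eval q (eval h x) + eval h x     ≡⟨ cong (λ y → L * y + eval h x) (eval-cong q (scale A t²-2t+4) q≈ (eval h x)) ⟩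
    L * eval (scale A t²-2t+4) (eval h x) + eval h x ≡⟨ identity L A x ⟩
    eval G′ x                            ∎
    where
    identity : ∀ L A x → let y = 0ℚ + x * (- L + x * 0ℚ) in
      L * (A * (- 2 * - 2) + y * (A * - 2 + y * (A * 1ℚ + y * 0ℚ))) + y
      ≡ L * A * 4 + x * (L * L * A * 2 - L + x * (L * L * L * A + x * 0ℚ))
    identity = solve-∀ ℚ-ring
  g∘h-factor : g ∘ₚ h ≈ₚ scale (coeff (g ∘ₚ h) 2) t²-2t+4
  g∘h-factor = quadratic-factor-of-cube-difference (g ∘ₚ h) (- 2)
    (degree-resp-≈ G′ (g ∘ₚ h) (λ i → sym (g∘h≈G′ i)) (quadratic-degree _ _ (*-≢0 (*-≢0 (*-≢0 L≢0 L≢0) L≢0) A≢0)))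
    (reduced-second-factor q g L g≈ qg∣)
  compare : ∀ i → coeff G′ i ≡ L * L * L * A * coeff t²-2t+4 i
  compare i = begin
    coeff G′ i                                  ≡⟨ sym (g∘h≈G′ i) ⟩
    coeff (g ∘ₚ h) i                            ≡⟨ g∘h-factor i ⟩
    coeff (scale (coeff (g ∘ₚ h) 2) t²-2t+4) i  ≡⟨ coeff-scale (coeff (g ∘ₚ h) 2) t²-2t+4 i ⟩
    coeff (g ∘ₚ h) 2 * coeff t²-2t+4 i          ≡⟨ cong (_* coeff t²-2t+4 i) (g∘h≈G′ 2) ⟩
    L * L * L * A * coeff t²-2t+4 i             ∎
  coefficients : L ≡ 1ℚ × A * 4 ≡ 1ℚ
  coefficients = L≡1∧4A≡1 L A L≢0 A≢0 (compare 0) (compare 1)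

composite-not-linear : ∀ p h {n} → HasDegree h n → 2 ℕ.≤ n → ¬ HasDegree (p ∘ₚ h) 1
composite-not-linear p h {suc n} h-deg 2≤n p∘h-deg with zero-or-degree p
... | inj₁ p≈0         = proj₁ p∘h-deg (∘ₚ-≈[] p h p≈0 1)
... | inj₂ (m , p-deg) = contradiction (subst (2 ℕ.≤_) n≡1 2≤n) λ { (s≤s ()) }
  where
  n≡1 : suc n ≡ 1
  n≡1 = ℕP.m*n≡1⇒n≡1 m (suc n) (degree-unique (p ∘ₚ h) (∘ₚ-degree p h p-deg h-deg) p∘h-deg)

linear-remainder : ∀ f g → HasDegree f 2 → HasDegree g 2 →
                   ∃[ L ] ∃[ n ] ∃[ m ] (L ≢ 0ℚ × (∀ x → eval g x ≡ L * eval f x + (n + x * m)))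
linear-remainder f g (a≢0 , f-bound) (d≢0 , g-bound) = L , k - L * c , e - L * b , L≢0 , eval-g
  where
  instance _ = ≢-nonZero a≢0
  c = coeff f 0
  b = coeff f 1
  a = coeff f 2
  k = coeff g 0
  e = coeff g 1
  d = coeff g 2
  L = d * 1/ a
  d≡La : d ≡ L * a
  d≡La = begin
    d                ≡⟨ sym (ℚP.*-identityʳ d) ⟩
    d * 1ℚ           ≡⟨ cong (d *_) (sym (ℚP.*-inverseˡ a)) ⟩
    d * (1/ a * a)   ≡⟨ sym (ℚP.*-assoc d (1/ a) a) ⟩
    L * a            ∎
  L≢0 : L ≢ 0ℚ
  L≢0 L≡0 = d≢0 (trans d≡La (trans (cong (_* a) L≡0) (ℚP.*-zeroˡ a)))
  eval-g : ∀ x → eval g x ≡ L * eval f x + (k - L * c + x * (e - L * b))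
  eval-g x = begin
    eval g x                                            ≡⟨ eval-cong g (k ∷ e ∷ d ∷ []) (≈ₚ-tabulate g 3 g-bound) x ⟩
    k + x * (e + x * (d + x * 0ℚ))                      ≡⟨ cong (λ d → k + x * (e + x * (d + x * 0ℚ))) d≡La ⟩
    k + x * (e + x * (L * a + x * 0ℚ))                  ≡⟨ identity k e L a b c x ⟩
    L * (c + x * (b + x * (a + x * 0ℚ))) + (k - L * c + x * (e - L * b))
      ≡⟨ cong (λ y → L * y + (k - L * c + x * (e - L * b))) (sym (eval-cong f (c ∷ b ∷ a ∷ []) (≈ₚ-tabulate f 3 f-bound) x)) ⟩
    L * eval f x + (k - L * c + x * (e - L * b))        ∎
    where
    identity : ∀ k e L a b c x →
      k + x * (e + x * (L * a + x * 0ℚ)) ≡ L * (c + x * (b + x * (a + x * 0ℚ))) + (k - L * c + x * (e - L * b))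
    identity = solve-∀ ℚ-ring

affine-in⇒trivial : ∀ f g L n → HasDegree f 2 → (∀ x → eval g x ≡ L * eval f x + (n + x * 0ℚ)) → IsTrivial f g
affine-in⇒trivial f g L n f-deg eval-g = X , n ∷ L ∷ [] , f , (2 , ℕP.≤-refl , f-deg) , f≈X∘f , g≈ℓ∘f
  where
  f≈X∘f : f ≈ₚ X ∘ₚ f
  f≈X∘f = eval-injective f (X ∘ₚ f) λ x → sym (trans (eval-∘ₚ X f x) (eval-X (eval f x)))
  g≈ℓ∘f : g ≈ₚ (n ∷ L ∷ []) ∘ₚ f
  g≈ℓ∘f = eval-injective g ((n ∷ L ∷ []) ∘ₚ f) λ x → begin
    eval g x                                 ≡⟨ eval-g x ⟩
    L * eval f x + (n + x * 0ℚ)              ≡⟨ identity L (eval f x) n x ⟩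
    n + eval f x * (L + eval f x * 0ℚ)       ≡⟨ sym (eval-∘ₚ (n ∷ L ∷ []) f x) ⟩
    eval ((n ∷ L ∷ []) ∘ₚ f) x               ∎
    where
    identity : ∀ L y n x → L * y + (n + x * 0ℚ) ≡ n + y * (L + y * 0ℚ)
    identity = solve-∀ ℚ-ring

affine⁻¹ : ∀ m n .{{_ : NonZero m}} → Poly
affine⁻¹ m n = affine (1/ m) (- (n * 1/ m))

affine⁻¹-inverseˡ : ∀ m n .{{_ : NonZero m}} x → eval (affine⁻¹ m n) (n + x * m) ≡ x
affine⁻¹-inverseˡ m n x = begin
  - (n * 1/ m) + (n + x * m) * (1/ m + (n + x * m) * 0ℚ)  ≡⟨ identity n m (1/ m) x ⟩
  x * (m * 1/ m)                                          ≡⟨ cong (x *_) (ℚP.*-inverseʳ m) ⟩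
  x * 1ℚ                                                  ≡⟨ ℚP.*-identityʳ x ⟩
  x                                                       ∎
  where
  identity : ∀ n m μ x → - (n * μ) + (n + x * m) * (μ + (n + x * m) * 0ℚ) ≡ x * (m * μ)
  identity = solve-∀ ℚ-ring

affine⁻¹-inverseʳ : ∀ m n .{{_ : NonZero m}} s → n + eval (affine⁻¹ m n) s * m ≡ s
affine⁻¹-inverseʳ m n s = begin
  n + (- (n * 1/ m) + s * (1/ m + s * 0ℚ)) * m   ≡⟨ identity₁ n m (1/ m) s ⟩
  n + (s - n) * (m * 1/ m)                       ≡⟨ cong (λ y → n + (s - n) * y) (ℚP.*-inverseʳ m) ⟩
  n + (s - n) * 1ℚ                               ≡⟨ identity₂ n s ⟩
  s                                              ∎
  where
  identity₁ : ∀ n m μ s → n + (- (n * μ) + s * (μ + s * 0ℚ)) * m ≡ n + (s - n) * (m * μ)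
  identity₁ = solve-∀ ℚ-ring
  identity₂ : ∀ n s → n + (s - n) * 1ℚ ≡ s
  identity₂ = solve-∀ ℚ-ring

affine⁻¹-degree : ∀ m n .{{_ : NonZero m}} → HasDegree (affine⁻¹ m n) 1
affine⁻¹-degree m n = affine-degree (- (n * 1/ m)) 1/m≢0
  where
  1/m≢0 : 1/ m ≢ 0ℚ
  1/m≢0 1/m≡0 = ℚP.1≢0 (trans (sym (ℚP.*-inverseʳ m)) (trans (cong (m *_) 1/m≡0) (ℚP.*-zeroʳ m)))

-- The substitution t = affine⁻¹ m n (s) turns (f, g) into a solution of the reduced equation.
reparametrise : ∀ f g L n m → L ≢ 0ℚ → m ≢ 0ℚ → HasDegree f 2 →
                (∀ x → eval g x ≡ L * eval f x + (n + x * m)) → f *ₚ g ∣ₚ cubes+8 f g →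
                f ≈ₚ F ∘ₚ affine (m * ½) (n * ½) × g ≈ₚ G ∘ₚ affine (m * ½) (n * ½)
reparametrise f g L n m L≢0 m≢0 f-deg eval-g fg∣ = f≈ , g≈
  where
  instance _ = ≢-nonZero m≢0
  σ = affine⁻¹ m n
  q = f ∘ₚ σ
  g∘σ≈ : g ∘ₚ σ ≈ₚ scale L q +ₚ X
  g∘σ≈ = eval-injective (g ∘ₚ σ) (scale L q +ₚ X) λ s → begin
    eval (g ∘ₚ σ) s                            ≡⟨ eval-∘ₚ g σ s ⟩
    eval g (eval σ s)                          ≡⟨ eval-g (eval σ s) ⟩
    L * eval f (eval σ s) + (n + eval σ s * m) ≡⟨ cong₂ (λ y z → L * y + z) (sym (eval-∘ₚ f σ s)) (affine⁻¹-inverseʳ m n s) ⟩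
    L * eval q s + s                           ≡⟨ sym (cong₂ _+_ (eval-scale L q s) (eval-X s)) ⟩
    eval (scale L q) s + eval X s              ≡⟨ sym (eval-+ₚ (scale L q) X s) ⟩
    eval (scale L q +ₚ X) s                    ∎
  reduced : L ≡ 1ℚ × q ≈ₚ F ∘ₚ affine ½ 0ℚ
  reduced = reduced-solution q (g ∘ₚ σ) L (∘ₚ-degree f σ f-deg (affine⁻¹-degree m n)) L≢0 g∘σ≈
              (divisibility-∘ₚ f g σ fg∣)
  y : ℚ → ℚ
  y x = eval (affine (m * ½) (n * ½)) x
  eval-f : ∀ x → eval f x ≡ eval F (y x)
  eval-f x = begin
    eval f x                                ≡⟨ cong (eval f) (sym (affine⁻¹-inverseˡ m n x)) ⟩
    eval f (eval σ (n + x * m))             ≡⟨ sym (eval-∘ₚ f σ (n + x * m)) ⟩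
    eval q (n + x * m)                      ≡⟨ eval-cong q (F ∘ₚ affine ½ 0ℚ) (proj₂ reduced) (n + x * m) ⟩
    eval (F ∘ₚ affine ½ 0ℚ) (n + x * m)     ≡⟨ eval-∘ₚ F (affine ½ 0ℚ) (n + x * m) ⟩
    eval F (eval (affine ½ 0ℚ) (n + x * m)) ≡⟨ cong (eval F) (identity n m x) ⟩
    eval F (y x)                            ∎
    where
    identity : ∀ n m x → 0ℚ + (n + x * m) * (½ + (n + x * m) * 0ℚ) ≡ n * ½ + x * (m * ½ + x * 0ℚ)
    identity = solve-∀ ℚ-ring
  f≈ : f ≈ₚ F ∘ₚ affine (m * ½) (n * ½)
  f≈ = eval-injective f (F ∘ₚ affine (m * ½) (n * ½)) λ x →
    trans (eval-f x) (sym (eval-∘ₚ F (affine (m * ½) (n * ½)) x))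
  g≈ : g ≈ₚ G ∘ₚ affine (m * ½) (n * ½)
  g≈ = eval-injective g (G ∘ₚ affine (m * ½) (n * ½)) λ x → begin
    eval g x                                 ≡⟨ eval-g x ⟩
    L * eval f x + (n + x * m)               ≡⟨ cong₂ (λ l u → l * u + (n + x * m)) (proj₁ reduced) (eval-f x) ⟩
    1ℚ * eval F (y x) + (n + x * m)          ≡⟨ identity n m x ⟩
    eval G (y x)                             ≡⟨ sym (eval-∘ₚ G (affine (m * ½) (n * ½)) x) ⟩
    eval (G ∘ₚ affine (m * ½) (n * ½)) x     ∎
    where
    identity : ∀ n m x → let y = n * ½ + x * (m * ½ + x * 0ℚ) in
      1ℚ * (1ℚ + y * (- 1ℚ + y * (1ℚ + y * 0ℚ))) + (n + x * m) ≡ 1ℚ + y * (1ℚ + y * (1ℚ + y * 0ℚ))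
    identity = solve-∀ ℚ-ring

solution⇒normal-form : ∀ f g → IsSolution f g → ¬ IsTrivial f g →
                       ∃[ α ] ∃[ β ] ((α ≢ 0ℚ) × (f ≈ₚ F ∘ₚ affine α β) × (g ≈ₚ G ∘ₚ affine α β))
solution⇒normal-form f g (f-deg , g-deg , fg∣) nontrivial =
  case linear-remainder f g f-deg g-deg of λ where
    (L , n , m , L≢0 , eval-g) → case m ℚP.≟ 0ℚ of λ where
      (yes m≡0) → ⊥-elim (nontrivial (affine-in⇒trivial f g L n f-deg λ x →
                    trans (eval-g x) (cong (λ m → L * eval f x + (n + x * m)) m≡0)))
      (no  m≢0) → m * ½ , n * ½ , *-≢0 m≢0 (λ ()) , reparametrise f g L n m L≢0 m≢0 f-deg eval-g fg∣

normal-form⇒solution : ∀ α β → α ≢ 0ℚ →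
                       IsSolution (F ∘ₚ affine α β) (G ∘ₚ affine α β)
                       × ¬ IsTrivial (F ∘ₚ affine α β) (G ∘ₚ affine α β)
normal-form⇒solution α β α≢0 = (F∘a-degree , G∘a-degree , divisibility-∘ₚ F G (affine α β) FG∣) , nontrivial
  where
  F∘a-degree : HasDegree (F ∘ₚ affine α β) 2
  F∘a-degree = ∘ₚ-degree F (affine α β) (quadratic-degree 1ℚ (- 1ℚ) ℚP.1≢0) (affine-degree β α≢0)
  G∘a-degree : HasDegree (G ∘ₚ affine α β) 2
  G∘a-degree = ∘ₚ-degree G (affine α β) (quadratic-degree 1ℚ 1ℚ ℚP.1≢0) (affine-degree β α≢0)
  FG∣ : F *ₚ G ∣ₚ cubes+8 F G
  FG∣ = ∣ₚ-by-eval (F *ₚ G) (cubes+8 F G) (10 ∷ 0ℚ ∷ 2 ∷ []) λ x → begin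
    eval (cubes+8 F G) x                                               ≡⟨ eval-cubes+8 F G x ⟩
    eval F x * eval F x * eval F x + eval G x * eval G x * eval G x + eight ≡⟨ identity x ⟩
    eval F x * eval G x * eval (10 ∷ 0ℚ ∷ 2 ∷ []) x                    ≡⟨ cong (_* eval (10 ∷ 0ℚ ∷ 2 ∷ []) x) (sym (eval-*ₚ F G x)) ⟩
    eval (F *ₚ G) x * eval (10 ∷ 0ℚ ∷ 2 ∷ []) x                        ∎
    where
    identity : ∀ x → let F = 1ℚ + x * (- 1ℚ + x * (1ℚ + x * 0ℚ)) ; G = 1ℚ + x * (1ℚ + x * (1ℚ + x * 0ℚ)) in
      F * F * F + G * G * G + eight ≡ F * G * (10 + x * (0ℚ + x * (2 + x * 0ℚ)))
    identity = solve-∀ ℚ-ring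
  nontrivial : ¬ IsTrivial (F ∘ₚ affine α β) (G ∘ₚ affine α β)
  nontrivial (f₁ , g₁ , h , (n , 2≤n , h-deg) , F≈f₁∘h , G≈g₁∘h) =
    composite-not-linear (g₁ -ₚ f₁) h h-deg 2≤n
      (degree-resp-≈ (affine (2 * α) (2 * β)) ((g₁ -ₚ f₁) ∘ₚ h) difference (affine-degree (2 * β) (*-≢0 {2} (λ ()) α≢0)))
    where
    difference : affine (2 * α) (2 * β) ≈ₚ (g₁ -ₚ f₁) ∘ₚ h
    difference = eval-injective (affine (2 * α) (2 * β)) ((g₁ -ₚ f₁) ∘ₚ h) λ x → sym (begin
      eval ((g₁ -ₚ f₁) ∘ₚ h) x                    ≡⟨ eval-∘ₚ (g₁ -ₚ f₁) h x ⟩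
      eval (g₁ -ₚ f₁) (eval h x)                  ≡⟨ eval-diff g₁ f₁ (eval h x) ⟩
      eval g₁ (eval h x) - eval f₁ (eval h x)     ≡⟨ sym (cong₂ _-_ (eval-∘ₚ g₁ h x) (eval-∘ₚ f₁ h x)) ⟩
      eval (g₁ ∘ₚ h) x - eval (f₁ ∘ₚ h) x         ≡⟨ sym (cong₂ _-_ (eval-cong (G ∘ₚ affine α β) (g₁ ∘ₚ h) G≈g₁∘h x)
                                                  (eval-cong (F ∘ₚ affine α β) (f₁ ∘ₚ h) F≈f₁∘h x)) ⟩
      eval (G ∘ₚ affine α β) x - eval (F ∘ₚ affine α β) x
        ≡⟨ cong₂ _-_ (eval-∘ₚ G (affine α β) x) (eval-∘ₚ F (affine α β) x) ⟩
      eval G (eval (affine α β) x) - eval F (eval (affine α β) x) ≡⟨ identity α β x ⟩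
      eval (affine (2 * α) (2 * β)) x             ∎)
      where
      identity : ∀ α β x → let y = β + x * (α + x * 0ℚ) in
        (1ℚ + y * (1ℚ + y * (1ℚ + y * 0ℚ))) - (1ℚ + y * (- 1ℚ + y * (1ℚ + y * 0ℚ))) ≡ 2 * β + x * (2 * α + x * 0ℚ)
      identity = solve-∀ ℚ-ring

corollary2p2 : ((f g : Poly) → IsSolution f g → ¬ IsTrivial f g →
                 ∃[ α ] ∃[ β ] ((α ≢ 0ℚ) × (f ≈ₚ F ∘ₚ affine α β) × (g ≈ₚ G ∘ₚ affine α β)))
               × ((α β : ℚ) → α ≢ 0ℚ →
                 IsSolution (F ∘ₚ affine α β) (G ∘ₚ affine α β)
                 × ¬ IsTrivial (F ∘ₚ affine α β) (G ∘ₚ affine α β))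
corollary2p2 = solution⇒normal-form , normal-form⇒solution
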